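{- For an integer $h\geq 1$ let $\Gamma_{2^h}$ denote the multiplicative circulant graph $MC(2^h)$. Then $$diam(\Gamma_{2^h})=\begin{cases} n & \text{if } h=2n,\\ n+1 & \text{if } h=2n+1.\end{cases}$$
   Context: For integers $m>1$, $h>0$, $MC(m^h)$ is the graph with vertex set $\mathbb{Z}_{m^h}$ in which distinct vertices $x,y$ are adjacent iff $x-y\equiv \pm m^i \pmod{m^h}$ for some $i\in\{0,\ldots,h-1\}$. $diam(\Gamma)$ is the maximum distance (shortest path length) between any pair of vertices of $\Gamma$. -}

module Defs where

open import Data.Nat using (ℕ; zero; suc; _+_; _*_; _^_; _<_; _≤_; NonZero)
open import Data.Nat.DivMod using (_%_)
open import Data.Nat.Properties using (m^n≢0)
open import Data.Fin using (Fin; toℕ)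
open import Data.Product using (Σ; ∃; _×_; _,_)
open import Relation.Binary.PropositionalEquality using (_≡_)
open import Relation.Nullary using (¬_)

Graph : ℕ → Set₁
Graph N = Fin N → Fin N → Set

-- Distinct x, y are adjacent iff x - y ≡ ± m^i (mod m^h) for some i ∈ {0,…,h-1}.
-- x - y ≡ m^i  (mod N)  ⇔  x ≡ y + m^i  (mod N);  x - y ≡ -m^i  ⇔  y ≡ x + m^i (mod N).
-- (The paper assumes m > 1; here we only need m ≠ 0 to form residues mod m^h,
-- and the theorem below uses m = 2.)
MC : (m h : ℕ) → .{{NonZero m}} → Graph (m ^ h)
MC m h x y =
  ¬ (x ≡ y) ×
  Σ ℕ (λ i → i < h ×
    ((toℕ x % (m ^ h) ≡ (toℕ y + m ^ i) % (m ^ h))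
     ⊎' (toℕ y % (m ^ h) ≡ (toℕ x + m ^ i) % (m ^ h))))
  where
  instance
    nz : NonZero (m ^ h)
    nz = m^n≢0 m h
  open import Data.Sum using () renaming (_⊎_ to _⊎'_)

data Walk {N : ℕ} (G : Graph N) : Fin N → Fin N → ℕ → Set where
  here : ∀ {x} → Walk G x x zero
  step : ∀ {x y z k} → G x y → Walk G y z k → Walk G x z (suc k)

DistLe : {N : ℕ} → Graph N → Fin N → Fin N → ℕ → Set
DistLe G x y k = Σ ℕ (λ j → j ≤ k × Walk G x y j)

IsDiameter : {N : ℕ} → Graph N → ℕ → Set
IsDiameter {N} G D =
  (∀ x y → DistLe G x y D) ×
  Σ (Fin N) (λ x → Σ (Fin N) (λ y → ∀ j → j < D → ¬ Walk G x y j))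

-- In MC(2^h) a vertex y is adjacent to y ± 2^i, so dist(x, y) is the least number of signed
-- powers of two 2^i (i < h) summing to y − x modulo 2^h; call it the weight of y − x. Splitting
-- off the lowest binary digit gives a recursion in h: an even residue 2q weighs what q weighs one
-- level down, an odd one 2q + 1 = 1 + 2q = −1 + 2(q + 1) one more than the cheaper of q and q + 1.
-- As one of two consecutive numbers is even, two levels add at most one, so every weight is at
-- most ⌈h/2⌉; the residue …010101 attains ⌈h/2⌉, and since an edge changes the weight by at most
-- one, that residue is at distance ⌈h/2⌉ from 0.
module Submission where

open import Defs
open import Data.Nat using (ℕ; zero; suc; _+_; _*_; _∸_; _^_; _≤_; _<_; _⊓_; ⌊_/2⌋; ⌈_/2⌉; NonZero; z≤n; s≤s; z<s)
open import Data.Nat.Properties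
open import Data.Nat.DivMod using (_%_; _/_; m≡m%n+[m/n]*n; [m+kn]%n≡m%n; m%n<n; m<n⇒m%n≡m; %-distribˡ-+; m%n%n≡m%n)
open import Data.Nat.Tactic.RingSolver using (solve-∀)
open import Data.Fin using (Fin; toℕ; fromℕ<)
open import Data.Fin.Properties using (toℕ-injective; toℕ<n; toℕ-fromℕ<)
open import Data.Product using (_×_; _,_; proj₁; proj₂)
open import Data.Sum using (inj₁; inj₂)
open import Function using (_∘_)
open import Relation.Nullary using (¬_)
open import Relation.Binary.PropositionalEquality

data EvenOdd : ℕ → Set where
  even : ∀ q → EvenOdd (2 * q)
  odd  : ∀ q → EvenOdd (suc (2 * q))

evenOdd : ∀ x → EvenOdd x
evenOdd zero = even 0
evenOdd (suc x) with evenOdd x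
... | even q = odd q
... | odd q  = subst EvenOdd (*-suc 2 q) (even (suc q))

weightStep : (ℕ → ℕ) → ℕ → ℕ
weightStep w zero          = w 0
weightStep w (suc zero)    = suc (w 0 ⊓ w 1)
weightStep w (suc (suc x)) = weightStep (w ∘ suc) x

weight : ℕ → ℕ → ℕ
weight zero    _ = 0
weight (suc h)   = weightStep (weight h)

weightStep-even : ∀ w q → weightStep w (2 * q) ≡ w q
weightStep-even w zero    = refl
weightStep-even w (suc q) rewrite +-suc q (q + 0) = weightStep-even (w ∘ suc) q

weightStep-odd : ∀ w q → weightStep w (suc (2 * q)) ≡ suc (w q ⊓ w (suc q))
weightStep-odd w zero    = refl
weightStep-odd w (suc q) rewrite +-suc q (q + 0) = weightStep-odd (w ∘ suc) q

weight-even : ∀ h q → weight (suc h) (2 * q) ≡ weight h q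
weight-even h = weightStep-even (weight h)

weight-odd : ∀ h q → weight (suc h) (suc (2 * q)) ≡ suc (weight h q ⊓ weight h (suc q))
weight-odd h = weightStep-odd (weight h)

weight-even-suc : ∀ h q → weight (suc h) (suc (suc (2 * q))) ≡ weight h (suc q)
weight-even-suc h = weightStep-even (weight h ∘ suc)

weight-zero : ∀ h → weight h 0 ≡ 0
weight-zero zero    = refl
weight-zero (suc h) = weight-zero h

2*m+k*[2*n]≡2*[m+k*n] : ∀ m k n → 2 * m + k * (2 * n) ≡ 2 * (m + k * n)
2*m+k*[2*n]≡2*[m+k*n] = solve-∀

weight-periodic : ∀ h k x → weight h (x + k * 2 ^ h) ≡ weight h x
weight-periodic zero    k x = refl
weight-periodic (suc h) k x with evenOdd x
... | even q rewrite 2*m+k*[2*n]≡2*[m+k*n] q k (2 ^ h)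
                   | weight-even h (q + k * 2 ^ h) | weight-even h q
    = weight-periodic h k q
... | odd q rewrite 2*m+k*[2*n]≡2*[m+k*n] q k (2 ^ h)
                  | weight-odd h (q + k * 2 ^ h) | weight-odd h q
    = cong suc (cong₂ _⊓_ (weight-periodic h k q) (weight-periodic h k (suc q)))

Near : ℕ → ℕ → Set
Near a b = a ≤ suc b × b ≤ suc a

near-sym : ∀ {a b} → Near a b → Near b a
near-sym (p , q) = q , p

near-suc : ∀ {a b} → Near a b → Near (suc a) (suc b)
near-suc (p , q) = s≤s p , s≤s q

near-⊓ : ∀ {a a′ b b′} → Near a a′ → Near b b′ → Near (a ⊓ b) (a′ ⊓ b′)
near-⊓ (p , p′) (q , q′) = ⊓-mono-≤ p q , ⊓-mono-≤ p′ q′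

m≤1+n⇒m≤1+m⊓n : ∀ {m n} → m ≤ suc n → m ≤ suc (m ⊓ n)
m≤1+n⇒m≤1+m⊓n {m} m≤1+n = ⊓-glb (n≤1+n m) m≤1+n

near-suc-⊓ˡ : ∀ {a b} → Near a b → Near (suc (a ⊓ b)) a
near-suc-⊓ˡ {a} {b} (a≤1+b , _) = s≤s (m⊓n≤m a b) , m≤n⇒m≤1+n (m≤1+n⇒m≤1+m⊓n a≤1+b)

near-suc-⊓ʳ : ∀ {a b} → Near b a → Near (suc (a ⊓ b)) b
near-suc-⊓ʳ {a} {b} near rewrite ⊓-comm a b = near-suc-⊓ˡ near

weight-suc : ∀ h x → Near (weight h (suc x)) (weight h x)
weight-suc zero    x = z≤n , z≤n
weight-suc (suc h) x with evenOdd x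
... | even q rewrite weight-odd h q | weight-even h q
    = near-suc-⊓ˡ (near-sym (weight-suc h q))
... | odd q rewrite weight-even-suc h q | weight-odd h q
    = near-sym (near-suc-⊓ʳ (weight-suc h q))

weight-+2^ : ∀ h i x → Near (weight h (x + 2 ^ i)) (weight h x)
weight-+2^ zero    i       x = z≤n , z≤n
weight-+2^ (suc h) zero    x rewrite +-comm x 1 = weight-suc (suc h) x
weight-+2^ (suc h) (suc i) x with evenOdd x
... | even q rewrite sym (*-distribˡ-+ 2 q (2 ^ i))
                   | weight-even h (q + 2 ^ i) | weight-even h q
    = weight-+2^ h i q
... | odd q rewrite sym (*-distribˡ-+ 2 q (2 ^ i))
                  | weight-odd h (q + 2 ^ i) | weight-odd h q
    = near-suc (near-⊓ (weight-+2^ h i q) (weight-+2^ h i (suc q)))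

weight-suc-≤ : ∀ {b} h x → (∀ y → weight h y ≤ b) → weight (suc h) x ≤ suc b
weight-suc-≤ h x bound with evenOdd x
... | even q = ≤-trans (≤-reflexive (weight-even h q)) (m≤n⇒m≤1+n (bound q))
... | odd q  = ≤-trans (≤-reflexive (weight-odd h q)) (s≤s (≤-trans (m⊓n≤m _ _) (bound q)))

weight-⊓-consecutive-≤ : ∀ {b} h q → (∀ y → weight h y ≤ b) → weight (suc h) q ⊓ weight (suc h) (suc q) ≤ b
weight-⊓-consecutive-≤ h q bound with evenOdd q
... | even r = ≤-trans (m⊓n≤m _ _) (≤-trans (≤-reflexive (weight-even h r)) (bound r))
... | odd r  = ≤-trans (m⊓n≤n _ _) (≤-trans (≤-reflexive (weight-even-suc h r)) (bound (suc r)))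

weight≤⌈h/2⌉ : ∀ h x → weight h x ≤ ⌈ h /2⌉
weight≤⌈h/2⌉ zero          x = z≤n
weight≤⌈h/2⌉ (suc zero)    x = weight-suc-≤ 0 x (λ _ → z≤n)
weight≤⌈h/2⌉ (suc (suc h)) x with evenOdd x
... | even q = ≤-trans (≤-reflexive (weight-even (suc h) q)) (weight-suc-≤ h q (weight≤⌈h/2⌉ h))
... | odd q  = ≤-trans (≤-reflexive (weight-odd (suc h) q)) (s≤s (weight-⊓-consecutive-≤ h q (weight≤⌈h/2⌉ h)))

alternatingBits : ℕ → ℕ
alternatingBits zero          = 0
alternatingBits (suc zero)    = 1
alternatingBits (suc (suc h)) = suc (2 * (2 * alternatingBits h))

⌈h/2⌉≤weight-alternatingBits : ∀ h → ⌈ h /2⌉ ≤ weight h (alternatingBits h)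
⌈h/2⌉≤weight-alternatingBits zero          = z≤n
⌈h/2⌉≤weight-alternatingBits (suc zero)    = ≤-refl
⌈h/2⌉≤weight-alternatingBits (suc (suc h))
  rewrite weight-odd (suc h) (2 * alternatingBits h)
        | weight-even h (alternatingBits h) | weight-odd h (alternatingBits h)
  = s≤s (⊓-glb IH (≤-trans IH (m≤1+n⇒m≤1+m⊓n (proj₂ (weight-suc h t)))))
  where
  t = alternatingBits h
  IH = ⌈h/2⌉≤weight-alternatingBits h

MC-sym : ∀ {m h} .{{_ : NonZero m}} {x y} → MC m h x y → MC m h y x
MC-sym (x≢y , i , i<h , inj₁ e) = x≢y ∘ sym , i , i<h , inj₂ e
MC-sym (x≢y , i , i<h , inj₂ e) = x≢y ∘ sym , i , i<h , inj₁ e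

module _ {N : ℕ} {G : Graph N} where

  distLe-refl : ∀ {x} → DistLe G x x 0
  distLe-refl = 0 , z≤n , here

  distLe-step : ∀ {x y z k} → G x y → DistLe G y z k → DistLe G x z (suc k)
  distLe-step e (j , j≤k , w) = suc j , s≤s j≤k , step e w

  distLe-mono : ∀ {x y k l} → k ≤ l → DistLe G x y k → DistLe G x y l
  distLe-mono k≤l (j , j≤k , w) = j , ≤-trans j≤k k≤l , w

  distLe-⊓ : ∀ {x y k l} → DistLe G x y k → DistLe G x y l → DistLe G x y (k ⊓ l)
  distLe-⊓ {x} {y} {k} {l} dk dl with ⊓-sel k l
  ... | inj₁ k⊓l≡k = subst (DistLe G x y) (sym k⊓l≡k) dk
  ... | inj₂ k⊓l≡l = subst (DistLe G x y) (sym k⊓l≡l) dl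

[m+n]%d≢m : ∀ {m n d} .{{_ : NonZero d}} → 0 < n → n < d → (m + n) % d ≢ m
[m+n]%d≢m {m} {n} {d} 0<n n<d eq = notMultiple ((m + n) / d) (+-cancelˡ-≡ m n _ (begin
  m + n                         ≡⟨ m≡m%n+[m/n]*n (m + n) d ⟩
  (m + n) % d + (m + n) / d * d ≡⟨ cong (_+ (m + n) / d * d) eq ⟩
  m + (m + n) / d * d           ∎))
  where
  open ≡-Reasoning
  notMultiple : ∀ k → n ≢ k * d
  notMultiple zero    n≡0   = <⇒≢ 0<n (sym n≡0)
  notMultiple (suc k) n≡kd = <⇒≱ n<d (subst (d ≤_) (sym n≡kd) (m≤m+n d _))

module _ (h : ℕ) where

  private
    N : ℕ
    N = 2 ^ h

    instance
      N≢0 : NonZero N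
      N≢0 = m^n≢0 2 h

  2^<N : ∀ {s} → s < h → 2 ^ s < N
  2^<N = ^-monoʳ-< 2 (n<1+n 1)

  weight-mod : ∀ x → weight h (x % N) ≡ weight h x
  weight-mod x = begin
    weight h (x % N)                ≡⟨ weight-periodic h (x / N) (x % N) ⟨
    weight h (x % N + x / N * N)    ≡⟨ cong (weight h) (m≡m%n+[m/n]*n x N) ⟨
    weight h x                      ∎
    where open ≡-Reasoning

  weight-cong-% : ∀ {a b} → a % N ≡ b % N → weight h a ≡ weight h b
  weight-cong-% {a} {b} a≡b = trans (sym (weight-mod a)) (trans (cong (weight h) a≡b) (weight-mod b))

  weight-edge : ∀ {x y} → MC 2 h x y → weight h (toℕ y) ≤ suc (weight h (toℕ x))
  weight-edge {x} {y} (_ , i , _ , inj₁ x≡y+2^i) =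
    subst (λ w → weight h (toℕ y) ≤ suc w) (sym (weight-cong-% x≡y+2^i)) (proj₂ (weight-+2^ h i (toℕ y)))
  weight-edge {x} {y} (_ , i , _ , inj₂ y≡x+2^i) =
    subst (_≤ suc (weight h (toℕ x))) (sym (weight-cong-% y≡x+2^i)) (proj₁ (weight-+2^ h i (toℕ x)))

  weight-walk : ∀ {x y j} → Walk (MC 2 h) x y j → weight h (toℕ y) ≤ weight h (toℕ x) + j
  weight-walk here = m≤m+n _ 0
  weight-walk {x} {z} (step {y = y} {k = k} e w) = begin
    weight h (toℕ z)          ≤⟨ weight-walk w ⟩
    weight h (toℕ y) + k      ≤⟨ +-monoˡ-≤ k (weight-edge e) ⟩
    suc (weight h (toℕ x)) + k ≡⟨ +-suc _ k ⟨
    weight h (toℕ x) + suc k  ∎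
    where open ≤-Reasoning

  infixl 6 _⊕_
  _⊕_ : Fin N → ℕ → Fin N
  y ⊕ a = fromℕ< (m%n<n (toℕ y + a) N)

  toℕ-⊕ : ∀ y a → toℕ (y ⊕ a) ≡ (toℕ y + a) % N
  toℕ-⊕ y a = toℕ-fromℕ< _

  ⊕-assoc : ∀ y a b → y ⊕ a ⊕ b ≡ y ⊕ (a + b)
  ⊕-assoc y a b = toℕ-injective (begin
    toℕ (y ⊕ a ⊕ b)                     ≡⟨ toℕ-⊕ (y ⊕ a) b ⟩
    (toℕ (y ⊕ a) + b) % N               ≡⟨ cong (λ v → (v + b) % N) (toℕ-⊕ y a) ⟩
    ((toℕ y + a) % N + b) % N           ≡⟨ %-distribˡ-+ ((toℕ y + a) % N) b N ⟩
    ((toℕ y + a) % N % N + b % N) % N   ≡⟨ cong (λ v → (v + b % N) % N) (m%n%n≡m%n (toℕ y + a) N) ⟩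
    ((toℕ y + a) % N + b % N) % N       ≡⟨ %-distribˡ-+ (toℕ y + a) b N ⟨
    (toℕ y + a + b) % N                 ≡⟨ cong (_% N) (+-assoc (toℕ y) a b) ⟩
    (toℕ y + (a + b)) % N               ≡⟨ toℕ-⊕ y (a + b) ⟨
    toℕ (y ⊕ (a + b))                   ∎)
    where open ≡-Reasoning

  ⊕-multiple : ∀ y k → y ⊕ k * N ≡ y
  ⊕-multiple y k = toℕ-injective (begin
    toℕ (y ⊕ k * N)      ≡⟨ toℕ-⊕ y (k * N) ⟩
    (toℕ y + k * N) % N  ≡⟨ [m+kn]%n≡m%n (toℕ y) k N ⟩
    toℕ y % N            ≡⟨ m<n⇒m%n≡m (toℕ<n y) ⟩
    toℕ y                ∎)
    where open ≡-Reasoning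

  ⊕-2^-adjacent : ∀ {s} → s < h → ∀ y → MC 2 h y (y ⊕ 2 ^ s)
  ⊕-2^-adjacent {s} s<h y = y≢y⊕2^s , s , s<h , inj₂ (trans (m<n⇒m%n≡m (toℕ<n _)) (toℕ-⊕ y (2 ^ s)))
    where
    y≢y⊕2^s : y ≢ y ⊕ 2 ^ s
    y≢y⊕2^s y≡ = [m+n]%d≢m (m^n>0 2 s) (2^<N s<h) (trans (sym (toℕ-⊕ y (2 ^ s))) (cong toℕ (sym y≡)))

  ⊕-∸-cancel : ∀ {a} → a ≤ N → ∀ y → y ⊕ (N ∸ a) ⊕ a ≡ y
  ⊕-∸-cancel {a} a≤N y = begin
    y ⊕ (N ∸ a) ⊕ a    ≡⟨ ⊕-assoc y (N ∸ a) a ⟩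
    y ⊕ (N ∸ a + a)    ≡⟨ cong (y ⊕_) (m∸n+n≡m a≤N) ⟩
    y ⊕ N              ≡⟨ cong (y ⊕_) (*-identityˡ N) ⟨
    y ⊕ 1 * N          ≡⟨ ⊕-multiple y 1 ⟩
    y                  ∎
    where open ≡-Reasoning

  ⊕-2^-adjacent⁻ : ∀ {s} → s < h → ∀ y → MC 2 h y (y ⊕ (N ∸ 2 ^ s))
  ⊕-2^-adjacent⁻ {s} s<h y =
    subst (λ z → MC 2 h z (y ⊕ (N ∸ 2 ^ s))) (⊕-∸-cancel (<⇒≤ (2^<N s<h)) y)
      (MC-sym (⊕-2^-adjacent s<h (y ⊕ (N ∸ 2 ^ s))))

  ⊕-odd⁺ : ∀ y s q → y ⊕ 2 ^ s ⊕ 2 ^ suc s * q ≡ y ⊕ 2 ^ s * suc (2 * q)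
  ⊕-odd⁺ y s q = trans (⊕-assoc y (2 ^ s) _) (cong (y ⊕_) (m+2*m*n≡m*[1+2*n] (2 ^ s) q))
    where
    m+2*m*n≡m*[1+2*n] : ∀ m n → m + 2 * m * n ≡ m * suc (2 * n)
    m+2*m*n≡m*[1+2*n] = solve-∀

  ⊕-odd⁻ : ∀ {s} → s < h → ∀ y q → y ⊕ (N ∸ 2 ^ s) ⊕ 2 ^ suc s * suc q ≡ y ⊕ 2 ^ s * suc (2 * q)
  ⊕-odd⁻ {s} s<h y q = begin
    y ⊕ (N ∸ p) ⊕ 2 * p * suc q            ≡⟨ ⊕-assoc y (N ∸ p) _ ⟩
    y ⊕ (N ∸ p + 2 * p * suc q)            ≡⟨ cong (y ⊕_) (c+2*m*[1+n]≡m*[1+2*n]+1*[c+m] (N ∸ p) p q) ⟩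
    y ⊕ (p * suc (2 * q) + 1 * (N ∸ p + p)) ≡⟨ cong (λ c → y ⊕ (p * suc (2 * q) + 1 * c)) (m∸n+n≡m (<⇒≤ (2^<N s<h))) ⟩
    y ⊕ (p * suc (2 * q) + 1 * N)           ≡⟨ ⊕-assoc y _ (1 * N) ⟨
    y ⊕ p * suc (2 * q) ⊕ 1 * N             ≡⟨ ⊕-multiple _ 1 ⟩
    y ⊕ p * suc (2 * q)                     ∎
    where
    open ≡-Reasoning
    p = 2 ^ s
    c+2*m*[1+n]≡m*[1+2*n]+1*[c+m] : ∀ c m n → c + 2 * m * suc n ≡ m * suc (2 * n) + 1 * (c + m)
    c+2*m*[1+n]≡m*[1+2*n]+1*[c+m] = solve-∀

  -- The walk follows the weight recursion, reading the digits of a at positions s, …, h − 1.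
  distLe-⊕-2^ : ∀ k s → s + k ≡ h → ∀ a y → DistLe (MC 2 h) y (y ⊕ 2 ^ s * a) (weight k a)
  distLe-⊕-2^ zero s s+0≡h a y = subst (λ z → DistLe (MC 2 h) y z 0) (sym y⊕2^s*a≡y) distLe-refl
    where
    y⊕2^s*a≡y : y ⊕ 2 ^ s * a ≡ y
    y⊕2^s*a≡y = begin
      y ⊕ 2 ^ s * a  ≡⟨ cong (λ s → y ⊕ 2 ^ s * a) (trans (sym (+-identityʳ s)) s+0≡h) ⟩
      y ⊕ N * a      ≡⟨ cong (y ⊕_) (*-comm N a) ⟩
      y ⊕ a * N      ≡⟨ ⊕-multiple y a ⟩
      y              ∎
      where open ≡-Reasoning
  distLe-⊕-2^ (suc k) s s+k≡h a y with evenOdd a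
  ... | even q = subst₂ (DistLe (MC 2 h) y) (cong (y ⊕_) 2*2^s*q≡2^s*[2*q]) (sym (weight-even k q))
                   (distLe-⊕-2^ k (suc s) (trans (sym (+-suc s k)) s+k≡h) q y)
    where
    2*2^s*q≡2^s*[2*q] : 2 * 2 ^ s * q ≡ 2 ^ s * (2 * q)
    2*2^s*q≡2^s*[2*q] = trans (cong (_* q) (*-comm 2 (2 ^ s))) (*-assoc (2 ^ s) 2 q)
  ... | odd q = subst (DistLe (MC 2 h) y (y ⊕ 2 ^ s * suc (2 * q))) (sym (weight-odd k q))
                  (distLe-⊓ viaPlus viaMinus)
    where
    s<h : s < h
    s<h = subst (s <_) s+k≡h (m<m+n s z<s)
    recurse : ∀ b z → DistLe (MC 2 h) z (z ⊕ 2 ^ suc s * b) (weight k b)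
    recurse = distLe-⊕-2^ k (suc s) (trans (sym (+-suc s k)) s+k≡h)
    viaPlus : DistLe (MC 2 h) y (y ⊕ 2 ^ s * suc (2 * q)) (suc (weight k q))
    viaPlus = distLe-step (⊕-2^-adjacent s<h y)
                (subst (λ z → DistLe (MC 2 h) _ z _) (⊕-odd⁺ y s q) (recurse q (y ⊕ 2 ^ s)))
    viaMinus : DistLe (MC 2 h) y (y ⊕ 2 ^ s * suc (2 * q)) (suc (weight k (suc q)))
    viaMinus = distLe-step (⊕-2^-adjacent⁻ s<h y)
                 (subst (λ z → DistLe (MC 2 h) _ z _) (⊕-odd⁻ s<h y q) (recurse (suc q) (y ⊕ (N ∸ 2 ^ s))))

  distLe-⊕ : ∀ a y → DistLe (MC 2 h) y (y ⊕ a) (weight h a)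
  distLe-⊕ a y = subst (λ b → DistLe (MC 2 h) y (y ⊕ b) (weight h a)) (*-identityˡ a) (distLe-⊕-2^ h 0 refl a y)

  ⊕-difference : ∀ x y → x ⊕ (toℕ y + (N ∸ toℕ x)) ≡ y
  ⊕-difference x y = toℕ-injective (begin
    toℕ (x ⊕ (toℕ y + (N ∸ toℕ x)))           ≡⟨ toℕ-⊕ x _ ⟩
    (toℕ x + (toℕ y + (N ∸ toℕ x))) % N       ≡⟨ cong (_% N) (a+[b+c]≡b+1*[c+a] (toℕ x) (toℕ y) _) ⟩
    (toℕ y + 1 * (N ∸ toℕ x + toℕ x)) % N     ≡⟨ cong (λ c → (toℕ y + 1 * c) % N) (m∸n+n≡m (<⇒≤ (toℕ<n x))) ⟩
    (toℕ y + 1 * N) % N                       ≡⟨ [m+kn]%n≡m%n (toℕ y) 1 N ⟩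
    toℕ y % N                                 ≡⟨ m<n⇒m%n≡m (toℕ<n y) ⟩
    toℕ y                                     ∎)
    where
    open ≡-Reasoning
    a+[b+c]≡b+1*[c+a] : ∀ a b c → a + (b + c) ≡ b + 1 * (c + a)
    a+[b+c]≡b+1*[c+a] = solve-∀

  origin : Fin N
  origin = fromℕ< (m^n>0 2 h)

  weight-origin-⊕ : ∀ a → weight h (toℕ (origin ⊕ a)) ≡ weight h a
  weight-origin-⊕ a = begin
    weight h (toℕ (origin ⊕ a))        ≡⟨ cong (weight h) (toℕ-⊕ origin a) ⟩
    weight h ((toℕ origin + a) % N)    ≡⟨ cong (λ v → weight h ((v + a) % N)) (toℕ-fromℕ< _) ⟩
    weight h (a % N)                   ≡⟨ weight-mod a ⟩
    weight h a                         ∎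
    where open ≡-Reasoning

  MC2-diameter : IsDiameter (MC 2 h) ⌈ h /2⌉
  MC2-diameter = within , origin , origin ⊕ alternatingBits h , far
    where
    within : ∀ x y → DistLe (MC 2 h) x y ⌈ h /2⌉
    within x y = distLe-mono (weight≤⌈h/2⌉ h d)
                   (subst (λ z → DistLe (MC 2 h) x z (weight h d)) (⊕-difference x y) (distLe-⊕ d x))
      where
      d = toℕ y + (N ∸ toℕ x)
    far : ∀ j → j < ⌈ h /2⌉ → ¬ Walk (MC 2 h) origin (origin ⊕ alternatingBits h) j
    far j j<⌈h/2⌉ w = <⇒≱ j<⌈h/2⌉ (begin
      ⌈ h /2⌉                                      ≤⟨ ⌈h/2⌉≤weight-alternatingBits h ⟩
      weight h (alternatingBits h)                 ≡⟨ weight-origin-⊕ (alternatingBits h) ⟨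
      weight h (toℕ (origin ⊕ alternatingBits h))  ≤⟨ weight-walk w ⟩
      weight h (toℕ origin) + j                    ≡⟨ cong (λ v → weight h v + j) (toℕ-fromℕ< _) ⟩
      weight h 0 + j                               ≡⟨ cong (_+ j) (weight-zero h) ⟩
      j                                            ∎)
      where open ≤-Reasoning

⌈2*n/2⌉≡n : ∀ n → ⌈ 2 * n /2⌉ ≡ n
⌈2*n/2⌉≡n n = trans (cong (λ m → ⌈ n + m /2⌉) (+-identityʳ n)) (sym (n≡⌈n+n/2⌉ n))

⌈2*n+1/2⌉≡n+1 : ∀ n → ⌈ 2 * n + 1 /2⌉ ≡ n + 1
⌈2*n+1/2⌉≡n+1 n = begin
  ⌊ suc (2 * n + 1) /2⌋  ≡⟨ cong ⌊_/2⌋ (2+2*n≡[1+n]+[1+n] n) ⟩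
  ⌊ suc n + suc n /2⌋    ≡⟨ n≡⌊n+n/2⌋ (suc n) ⟨
  suc n                  ≡⟨ +-comm 1 n ⟩
  n + 1                  ∎
  where
  open ≡-Reasoning
  2+2*n≡[1+n]+[1+n] : ∀ n → suc (2 * n + 1) ≡ suc n + suc n
  2+2*n≡[1+n]+[1+n] = solve-∀

corollary3p9 : (n : ℕ) →
    (1 ≤ 2 * n → IsDiameter (MC 2 (2 * n)) n) × IsDiameter (MC 2 (2 * n + 1)) (n + 1)
corollary3p9 n =
  (λ _ → subst (IsDiameter (MC 2 (2 * n))) (⌈2*n/2⌉≡n n) (MC2-diameter (2 * n))) ,
  subst (IsDiameter (MC 2 (2 * n + 1))) (⌈2*n+1/2⌉≡n+1 n) (MC2-diameter (2 * n + 1))
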